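{- Let $H$ be an ordered graph, let $\sigma=r_<(H,H,H)$, $\epsilon=\tfrac14\sigma^{ -\sigma}$, $\delta=|E(H)|\cdot\tfrac12\sigma^{ -\sigma}$, and let $n\ge\sigma$. Let $K_n$ be the complete ordered graph on vertex set $[n]$. If $E_1,E_2\subseteq E(K_n)$ are such that for each $i\in\{1,2\}$ there are at most $\epsilon n^{|V(H)|}$ copies of $H$ in $K_n$ all of whose edges lie in $E_i$, then $|E_1\cup E_2|\le(1-\delta)\binom n2$.
   Context: An ordered graph is a finite simple graph together with a linear order of its vertex set. A copy of an ordered graph $H$ in $F$ is a subgraph of $F$ (with inherited order) isomorphic to $H$ via an order-preserving bijection. $r_<(H,H,H)$ denotes the $3$-color ordered Ramsey number of $H$: the smallest integer $N$ such that every coloring of the edges of the complete ordered graph on $N$ vertices with three colors contains a monochromatic copy of $H$. -}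

module Defs where

open import Data.Nat using (ℕ; zero; suc)
open import Data.Bool using (Bool; true; false; _∨_)
open import Data.Fin using (Fin; _<_; _<?_)
open import Data.Fin.Properties using (all?)
open import Data.List using (List; []; _∷_; map; concatMap; filter; length)
open import Data.List.Base using (allFin)
open import Data.Product using (Σ; _×_; _,_; proj₁; proj₂; ∃)
open import Data.Vec.Functional as VF using ()
open import Relation.Nullary using (Dec; yes; no)
open import Relation.Nullary.Decidable using (_×-dec_; _→-dec_)
open import Relation.Binary.PropositionalEquality using (_≡_)
import Data.Bool.Properties as BP

-- An ordered graph on k vertices: vertex set Fin k with its natural order.
-- (Every finite ordered graph is order-isomorphic to one of these.)
-- The edge {i,j} with i < j is present iff adj i j ≡ true; values of adj
-- at pairs (i,j) with ¬ (i < j) are ignored.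
record OGraph : Set where
  field
    size : ℕ
    adj  : Fin size → Fin size → Bool
open OGraph public

-- A (symmetric-agnostic) relation on [n], read only on pairs i < j.
-- Edge sets of K_n and edge colorings are represented this way.

-- f : Fin k → Fin n witnesses a copy of H in K_n all of whose edges satisfy P:
-- f is order preserving (strictly increasing) and maps every edge of H to a pair
-- satisfying P.  Copies (as subgraphs) correspond bijectively to such f.
IsCopy : (H : OGraph) {n : ℕ} → (Fin n → Fin n → Set) → (Fin (size H) → Fin n) → Set
IsCopy H P f =
  (∀ i j → i < j → f i < f j) ×
  (∀ i j → i < j → adj H i j ≡ true → P (f i) (f j))

InE : {n : ℕ} → (Fin n → Fin n → Bool) → Fin n → Fin n → Set
InE E a b = E a b ≡ true

isCopy? : (H : OGraph) {n : ℕ} (E : Fin n → Fin n → Bool) (f : Fin (size H) → Fin n) →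
          Dec (IsCopy H (InE E) f)
isCopy? H E f =
  all? (λ i → all? (λ j → (i <? j) →-dec (f i <? f j)))
  ×-dec
  all? (λ i → all? (λ j → (i <? j) →-dec ((adj H i j BP.≟ true) →-dec (E (f i) (f j) BP.≟ true))))

allFuns : (k n : ℕ) → List (Fin k → Fin n)
allFuns zero    n = (λ ()) ∷ []
allFuns (suc k) n = concatMap (λ x → map (λ g → x VF.∷ g) (allFuns k n)) (allFin n)

numCopies : (H : OGraph) (n : ℕ) → (Fin n → Fin n → Bool) → ℕ
numCopies H n E = length (filter (isCopy? H E) (allFuns (size H) n))

allPairs : (n : ℕ) → List (Fin n × Fin n)
allPairs n = concatMap (λ i → map (λ j → (i , j)) (allFin n)) (allFin n)

countEdges : (n : ℕ) → (Fin n → Fin n → Bool) → ℕ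
countEdges n E =
  length (filter (λ p → (proj₁ p <? proj₂ p) ×-dec (E (proj₁ p) (proj₂ p) BP.≟ true)) (allPairs n))

numEdges : OGraph → ℕ
numEdges H = countEdges (size H) (adj H)

_∪E_ : {n : ℕ} → (Fin n → Fin n → Bool) → (Fin n → Fin n → Bool) → Fin n → Fin n → Bool
(E₁ ∪E E₂) a b = E₁ a b ∨ E₂ a b

Arrows3 : ℕ → OGraph → Set
Arrows3 N H =
  (c : Fin N → Fin N → Fin 3) →
  Σ (Fin 3) λ col → Σ (Fin (size H) → Fin N) λ f → IsCopy H (λ a b → c a b ≡ col) f

IsRamsey3 : OGraph → ℕ → Set
IsRamsey3 H σ = Arrows3 σ H × (∀ N → N Data.Nat.< σ → Arrows3 N H → Data.Empty.⊥)
  where import Data.Empty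

module Submission where

-- Colour each pair of Fin n by the first of E₁, E₂ and the complement of E₁ ∪ E₂
-- containing it.  Each σ-subset of Fin n contains a monochromatic copy of H, and a
-- k-subset (k = |V(H)|) lies in equally many σ-subsets, so there are at least
-- C(n,k) / C(σ,k) monochromatic copies.  Since E₁ and E₂ carry few copies, the bound
-- (n/k)^k ≤ C(n,k) leaves at least C(k,2) C(n,k) / 2σ^σ copies in the complement.
-- Each pair of Fin n lies in the same number C(n,k) C(k,2) / C(n,2) of k-subsets
-- and each copy has e(H) edges, so the complement has at least e(H) C(n,2) / 2σ^σ pairs.

open import Defs
open import Data.Nat using (ℕ; _+_; _*_; _^_; _≤_)
open import Data.Nat.Combinatorics using (_C_)
open import Data.Fin using (Fin)
open import Data.Bool using (Bool)

open import Data.Nat.Base using (zero; suc; _<_; _∸_; _!; z≤n; s≤s; s<s⁻¹; >-nonZero)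
open import Data.Nat.Properties
open import Algebra.Properties.CommutativeSemigroup +-commutativeSemigroup using () renaming (interchange to +-interchange)
open import Algebra.Properties.CommutativeSemigroup *-commutativeSemigroup using ()
  renaming (interchange to *-interchange; x∙yz≈y∙xz to x*[y*z]≡y*[x*z])
open import Data.Nat.Combinatorics using (nCk+nC[k+1]≡[n+1]C[k+1]; nCk≡nC[n∸k]; nCn≡1)
open import Data.Nat.Combinatorics.Base using (_P′_)
open import Data.Fin as Fin using (zero; suc)
import Data.Fin.Properties as Fin
open import Data.Vec.Functional using (_∷_)
open import Data.Bool using (true; false; not; _∨_; if_then_else_)
import Data.Bool.Properties as Bool
open import Data.List as List using (List; map; filter; length; concatMap; allFin; tabulate)
open import Data.List.Properties using (map-∘; map-++; map-cong; map-tabulate)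
open import Data.Nat.ListAction using (sum)
open import Data.Nat.ListAction.Properties using (sum-++)
open import Algebra.Properties.Monoid.Sum +-0-monoid using (sum-cong-≗; sum-replicate-zero) renaming (sum to ∑)
open import Relation.Nullary.Decidable using (_×-dec_)
open import Data.Product using (Σ; _×_; _,_; proj₁; proj₂)
open import Data.Sum using (_⊎_; inj₁; inj₂)
open import Data.Empty using (⊥-elim)
open import Data.Nat.Tactic.RingSolver using (solve-∀)
open import Function using (_∘_; id; const)
open import Relation.Nullary using (¬_; yes; no; Dec; does)
open import Relation.Binary.PropositionalEquality
open import Relation.Binary.Definitions using (tri<; tri≈; tri>)

variable
  k n σ : ℕ

-- Binomial coefficients

C>0 : k ≤ n → 0 < n C k
C>0 {zero}  {n}     _         = s≤s z≤n
C>0 {suc k} {suc n} (s≤s k≤n) =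
  ≤-trans (C>0 k≤n) (≤-trans (m≤m+n (n C k) (n C suc k)) (≤-reflexive (nCk+nC[k+1]≡[n+1]C[k+1] n k)))

C≤^ : ∀ n k → n C k ≤ n ^ k
C≤^ n       zero    = ≤-refl
C≤^ zero    (suc k) = z≤n
C≤^ (suc n) (suc k) = begin
  suc n C suc k              ≡⟨ nCk+nC[k+1]≡[n+1]C[k+1] n k ⟨
  n C k + n C suc k          ≤⟨ +-mono-≤ (C≤^ n k) (C≤^ n (suc k)) ⟩
  n ^ k + n * n ^ k          ≤⟨ +-mono-≤ (^-monoˡ-≤ k (n≤1+n n)) (*-monoʳ-≤ n (^-monoˡ-≤ k (n≤1+n n))) ⟩
  suc n ^ k + n * suc n ^ k  ≡⟨⟩
  suc n ^ suc k              ∎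
  where open ≤-Reasoning

P′-suc : ∀ n k → suc n P′ suc k ≡ suc n * (n P′ k)
P′-suc n zero    = refl
P′-suc n (suc k) = begin
  (n ∸ k) * (suc n P′ suc k)    ≡⟨ cong ((n ∸ k) *_) (P′-suc n k) ⟩
  (n ∸ k) * (suc n * (n P′ k))  ≡⟨ x*[y*z]≡y*[x*z] (n ∸ k) (suc n) (n P′ k) ⟩
  suc n * ((n ∸ k) * (n P′ k))  ∎
  where open ≡-Reasoning

P′≡0 : n < k → n P′ k ≡ 0
P′≡0 {n} {suc k} (s≤s n≤k) = cong (_* (n P′ k)) (m≤n⇒m∸n≡0 n≤k)

C*!≡P′ : ∀ n k → (n C k) * k ! ≡ n P′ k
C*!≡P′ n       zero    = refl
C*!≡P′ zero    (suc k) = sym (cong (_* (0 P′ k)) (0∸n≡0 k))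
C*!≡P′ (suc n) (suc k) = begin
  (suc n C suc k) * suc k !
    ≡⟨ cong (_* suc k !) (nCk+nC[k+1]≡[n+1]C[k+1] n k) ⟨
  (n C k + n C suc k) * (suc k * k !)
    ≡⟨ regroup (n C k) (n C suc k) (k !) k ⟩
  suc k * ((n C k) * k !) + (n C suc k) * suc k !
    ≡⟨ cong₂ (λ a b → suc k * a + b) (C*!≡P′ n k) (C*!≡P′ n (suc k)) ⟩
  suc k * (n P′ k) + (n ∸ k) * (n P′ k)
    ≡⟨ *-distribʳ-+ (n P′ k) (suc k) (n ∸ k) ⟨
  (suc k + (n ∸ k)) * (n P′ k)
    ≡⟨ falling k n ⟩
  suc n * (n P′ k)
    ≡⟨ P′-suc n k ⟨
  suc n P′ suc k ∎
  where
  open ≡-Reasoning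
  regroup : ∀ a b f k → (a + b) * (suc k * f) ≡ suc k * (a * f) + b * (suc k * f)
  regroup = solve-∀
  falling : ∀ k n → (suc k + (n ∸ k)) * (n P′ k) ≡ suc n * (n P′ k)
  falling k n with k ≤? n
  ... | yes k≤n = cong (λ m → suc m * (n P′ k)) (m+[n∸m]≡n k≤n)
  ... | no  k≰n rewrite P′≡0 (≰⇒> k≰n) = trans (*-zeroʳ (suc k + (n ∸ k))) (sym (*-zeroʳ (suc n)))

-- Termwise, (n ∸ i) / (k ∸ i) ≥ n / k for i < k ≤ n.
^*P′≤^*P′ : ∀ j k n → j ≤ k → k ≤ n → n ^ j * (k P′ j) ≤ k ^ j * (n P′ j)
^*P′≤^*P′ zero    k n _   _   = ≤-refl
^*P′≤^*P′ (suc j) k n j<k k≤n = begin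
  (n * n ^ j) * ((k ∸ j) * (k P′ j)) ≡⟨ *-interchange n (n ^ j) (k ∸ j) (k P′ j) ⟩
  (n * (k ∸ j)) * (n ^ j * (k P′ j)) ≤⟨ *-mono-≤ termwise (^*P′≤^*P′ j k n (<⇒≤ j<k) k≤n) ⟩
  (k * (n ∸ j)) * (k ^ j * (n P′ j)) ≡⟨ *-interchange k (k ^ j) (n ∸ j) (n P′ j) ⟨
  (k * k ^ j) * ((n ∸ j) * (n P′ j)) ∎
  where
  open ≤-Reasoning
  termwise : n * (k ∸ j) ≤ k * (n ∸ j)
  termwise = begin
    n * (k ∸ j)   ≡⟨ *-distribˡ-∸ n k j ⟩
    n * k ∸ n * j ≤⟨ ∸-mono (≤-reflexive (*-comm n k)) (*-monoˡ-≤ j k≤n) ⟩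
    k * n ∸ k * j ≡⟨ *-distribˡ-∸ k n j ⟨
    k * (n ∸ j)   ∎

C*^≤^ : k ≤ σ → (σ C k) * k ^ k ≤ σ ^ σ
C*^≤^ {k} {σ} k≤σ = begin
  (σ C k) * k ^ k           ≡⟨ cong (_* k ^ k) (nCk≡nC[n∸k] k≤σ) ⟩
  (σ C (σ ∸ k)) * k ^ k     ≤⟨ *-mono-≤ (C≤^ σ (σ ∸ k)) (^-monoˡ-≤ k k≤σ) ⟩
  σ ^ (σ ∸ k) * σ ^ k       ≡⟨ ^-distribˡ-+-* σ (σ ∸ k) k ⟨
  σ ^ (σ ∸ k + k)           ≡⟨ cong (σ ^_) (m∸n+n≡m k≤σ) ⟩
  σ ^ σ                     ∎
  where open ≤-Reasoning

^≤^*C : k ≤ n → n ^ k ≤ k ^ k * (n C k)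
^≤^*C {k} {n} k≤n = *-cancelʳ-≤ (n ^ k) (k ^ k * (n C k)) (k !) {{k !≢0}} (begin
  n ^ k * k !              ≡⟨ cong (n ^ k *_) k!≡k[P′]k ⟩
  n ^ k * (k P′ k)         ≤⟨ ^*P′≤^*P′ k k n ≤-refl k≤n ⟩
  k ^ k * (n P′ k)         ≡⟨ cong (k ^ k *_) (C*!≡P′ n k) ⟨
  k ^ k * ((n C k) * k !)  ≡⟨ *-assoc (k ^ k) (n C k) (k !) ⟨
  k ^ k * (n C k) * k !    ∎)
  where
  open ≤-Reasoning
  k!≡k[P′]k : k ! ≡ k P′ k
  k!≡k[P′]k = trans (sym (*-identityˡ (k !))) (trans (cong (_* k !) (sym (nCn≡1 k))) (C*!≡P′ k k))

C*^≤^*C : k ≤ σ → σ ≤ n → (σ C k) * n ^ k ≤ σ ^ σ * (n C k)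
C*^≤^*C {k} {σ} {n} k≤σ σ≤n = begin
  (σ C k) * n ^ k                ≤⟨ *-monoʳ-≤ (σ C k) (^≤^*C (≤-trans k≤σ σ≤n)) ⟩
  (σ C k) * (k ^ k * (n C k))    ≡⟨ *-assoc (σ C k) (k ^ k) (n C k) ⟨
  (σ C k) * k ^ k * (n C k)      ≤⟨ *-monoˡ-≤ (n C k) (C*^≤^ k≤σ) ⟩
  σ ^ σ * (n C k)                ∎
  where open ≤-Reasoning

C2≤^ : ∀ k → k C 2 ≤ k ^ k
C2≤^ zero          = z≤n
C2≤^ (suc zero)    = z≤n
C2≤^ k@(suc (suc _)) = ≤-trans (C≤^ k 2) (^-monoʳ-≤ k {2} {k} (s≤s (s≤s z≤n)))

binomial-estimate : k ≤ σ → σ ≤ n → (σ C k) * ((k C 2) * (n C k) + n ^ k) ≤ 2 * σ ^ σ * (n C k)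
binomial-estimate {k} {σ} {n} k≤σ σ≤n = begin
  (σ C k) * ((k C 2) * (n C k) + n ^ k)               ≡⟨ distribute (σ C k) (k C 2) (n C k) (n ^ k) ⟩
  (σ C k) * (k C 2) * (n C k) + (σ C k) * n ^ k       ≤⟨ +-mono-≤ (*-monoˡ-≤ (n C k) C*C2≤^) (C*^≤^*C k≤σ σ≤n) ⟩
  σ ^ σ * (n C k) + σ ^ σ * (n C k)                   ≡⟨ double (σ ^ σ) (n C k) ⟩
  2 * σ ^ σ * (n C k)                                 ∎
  where
  open ≤-Reasoning
  C*C2≤^ : (σ C k) * (k C 2) ≤ σ ^ σ
  C*C2≤^ = ≤-trans (*-monoʳ-≤ (σ C k) (C2≤^ k)) (C*^≤^ k≤σ)
  distribute : ∀ a b c d → a * (b * c + d) ≡ a * b * c + a * d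
  distribute = solve-∀
  double : ∀ x y → x * y + x * y ≡ 2 * x * y
  double = solve-∀

-- Sums over increasing maps

Map : ℕ → ℕ → Set
Map k n = Fin k → Fin n

Weight : ℕ → ℕ → Set
Weight k n = Map k n → ℕ

Increasing : Map k n → Set
Increasing f = ∀ i j → i Fin.< j → f i Fin.< f j

Extensional : Weight k n → Set
Extensional w = ∀ {f g} → f ≗ g → w f ≡ w g

shift : Map k n → Map k (suc n)
shift g = suc ∘ g

shift₀ : Map k n → Map (suc k) (suc n)
shift₀ g = zero ∷ shift g

shift-increasing : {g : Map k n} → Increasing g → Increasing (shift g)
shift-increasing g↑ i j i<j = s≤s (g↑ i j i<j)

shift₀-increasing : {g : Map k n} → Increasing g → Increasing (shift₀ g)
shift₀-increasing g↑ zero    (suc j) _         = s≤s z≤n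
shift₀-increasing g↑ (suc i) (suc j) (s≤s i<j) = s≤s (g↑ i j i<j)

shift₀-cong : {g h : Map k n} → g ≗ h → shift₀ g ≗ shift₀ h
shift₀-cong g≗h zero    = refl
shift₀-cong g≗h (suc i) = cong suc (g≗h i)

-- Increasing maps Fin k → Fin n are the k-subsets of Fin n; an increasing map
-- into Fin (suc n) is either shift₀ or shift of an increasing map into Fin n.
∑↑ : (k n : ℕ) → Weight k n → ℕ
∑↑ zero    n       w = w (λ ())
∑↑ (suc k) zero    w = 0
∑↑ (suc k) (suc n) w = ∑↑ k n (w ∘ shift₀) + ∑↑ (suc k) n (w ∘ shift)

∑↑-cong : ∀ k n {w v : Weight k n} → w ≗ v → ∑↑ k n w ≡ ∑↑ k n v
∑↑-cong zero    n       w≗v = w≗v _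
∑↑-cong (suc k) zero    w≗v = refl
∑↑-cong (suc k) (suc n) w≗v =
  cong₂ _+_ (∑↑-cong k n (w≗v ∘ shift₀)) (∑↑-cong (suc k) n (w≗v ∘ shift))

∑↑-const : ∀ k n c → ∑↑ k n (const c) ≡ (n C k) * c
∑↑-const zero    n       c = sym (*-identityˡ c)
∑↑-const (suc k) zero    c = refl
∑↑-const (suc k) (suc n) c = begin
  ∑↑ k n (const c) + ∑↑ (suc k) n (const c) ≡⟨ cong₂ _+_ (∑↑-const k n c) (∑↑-const (suc k) n c) ⟩
  (n C k) * c + (n C suc k) * c             ≡⟨ *-distribʳ-+ c (n C k) (n C suc k) ⟨
  (n C k + n C suc k) * c                   ≡⟨ cong (_* c) (nCk+nC[k+1]≡[n+1]C[k+1] n k) ⟩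
  (suc n C suc k) * c                       ∎
  where open ≡-Reasoning

∑↑-count : ∀ k n → ∑↑ k n (const 1) ≡ n C k
∑↑-count k n = trans (∑↑-const k n 1) (*-identityʳ (n C k))

∑↑-+ : ∀ k n (w v : Weight k n) → ∑↑ k n (λ f → w f + v f) ≡ ∑↑ k n w + ∑↑ k n v
∑↑-+ zero    n       w v = refl
∑↑-+ (suc k) zero    w v = refl
∑↑-+ (suc k) (suc n) w v =
  trans (cong₂ _+_ (∑↑-+ k n _ _) (∑↑-+ (suc k) n _ _))
        (+-interchange (∑↑ k n (w ∘ shift₀)) (∑↑ k n (v ∘ shift₀))
                     (∑↑ (suc k) n (w ∘ shift)) (∑↑ (suc k) n (v ∘ shift)))

∑↑-*ˡ : ∀ k n c (w : Weight k n) → ∑↑ k n (λ f → c * w f) ≡ c * ∑↑ k n w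
∑↑-*ˡ zero    n       c w = refl
∑↑-*ˡ (suc k) zero    c w = sym (*-zeroʳ c)
∑↑-*ˡ (suc k) (suc n) c w =
  trans (cong₂ _+_ (∑↑-*ˡ k n c _) (∑↑-*ˡ (suc k) n c _))
        (sym (*-distribˡ-+ c (∑↑ k n (w ∘ shift₀)) (∑↑ (suc k) n (w ∘ shift))))

∑↑-mono : ∀ k n {w v : Weight k n} → (∀ f → Increasing f → w f ≤ v f) → ∑↑ k n w ≤ ∑↑ k n v
∑↑-mono zero    n       w≤v = w≤v _ (λ ())
∑↑-mono (suc k) zero    w≤v = z≤n
∑↑-mono (suc k) (suc n) w≤v =
  +-mono-≤ (∑↑-mono k n (λ f f↑ → w≤v _ (shift₀-increasing f↑)))
           (∑↑-mono (suc k) n (λ f f↑ → w≤v _ (shift-increasing f↑)))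

∑↑-cong↑ : ∀ k n {w v : Weight k n} → (∀ f → Increasing f → w f ≡ v f) → ∑↑ k n w ≡ ∑↑ k n v
∑↑-cong↑ k n w≡v = ≤-antisym (∑↑-mono k n (λ f f↑ → ≤-reflexive (w≡v f f↑)))
                             (∑↑-mono k n (λ f f↑ → ≤-reflexive (sym (w≡v f f↑))))

∑↑-empty : ∀ k n {w : Weight k n} → n < k → ∑↑ k n w ≡ 0
∑↑-empty (suc k) zero    n<k       = refl
∑↑-empty (suc k) (suc n) (s≤s n<k) =
  cong₂ _+_ (∑↑-empty k n n<k) (∑↑-empty (suc k) n (m<n⇒m<1+n n<k))

Positive : Fin n → Set
Positive x = 0 < Fin.toℕ x

pred⁺ : {x : Fin (suc n)} → Positive x → Σ (Fin n) λ y → x ≡ suc y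
pred⁺ {x = zero}  ()
pred⁺ {x = suc y} _ = y , refl

positive⇒shift : (f : Map k (suc n)) → (∀ i → Positive (f i)) → Increasing f →
                 Σ (Map k n) λ g → Increasing g × f ≗ shift g
positive⇒shift f f>0 f↑ = g , g↑ , f≗shift-g
  where
  g : Map _ _
  g i = proj₁ (pred⁺ (f>0 i))
  f≗shift-g : f ≗ shift g
  f≗shift-g i = proj₂ (pred⁺ (f>0 i))
  g↑ : Increasing g
  g↑ i j i<j = s<s⁻¹ (subst₂ Fin._<_ (f≗shift-g i) (f≗shift-g j) (f↑ i j i<j))

increasing-view : (f : Map (suc k) (suc n)) → Increasing f →
                  (Σ (Map k n) λ g → Increasing g × f ≗ shift₀ g) ⊎
                  (Σ (Map (suc k) n) λ g → Increasing g × f ≗ shift g)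
increasing-view f f↑ with f zero in f0≡
... | zero  = inj₁ (starts-at-zero (positive⇒shift (f ∘ suc) tail>0 (λ i j i<j → f↑ _ _ (s≤s i<j))))
  where
  starts-at-zero : (Σ (Map _ _) λ g → Increasing g × f ∘ suc ≗ shift g) →
                   Σ (Map _ _) λ g → Increasing g × f ≗ shift₀ g
  starts-at-zero (g , g↑ , tail≗) = g , g↑ , λ { zero → f0≡ ; (suc i) → tail≗ i }
  tail>0 : ∀ i → Positive (f (suc i))
  tail>0 i = ≤-trans (s≤s z≤n) (f↑ zero (suc i) (s≤s z≤n))
... | suc _ = inj₂ (positive⇒shift f f>0 f↑)
  where
  f>0 : ∀ i → Positive (f i)
  f>0 zero    = subst Positive (sym f0≡) (s≤s z≤n)
  f>0 (suc i) = ≤-trans (s≤s z≤n) (f↑ zero (suc i) (s≤s z≤n))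

term≤∑↑ : ∀ k n (w : Weight k n) → Extensional w → (f : Map k n) → Increasing f → w f ≤ ∑↑ k n w
term≤∑↑ zero    n       w w-ext f f↑ = ≤-reflexive (w-ext (λ ()))
term≤∑↑ (suc k) zero    w w-ext f f↑ = ⊥-elim (Fin.¬Fin0 (f zero))
term≤∑↑ (suc k) (suc n) w w-ext f f↑ with increasing-view f f↑
... | inj₁ (g , g↑ , f≗) = ≤-trans (≤-reflexive (w-ext f≗))
  (≤-trans (term≤∑↑ k n (w ∘ shift₀) (λ eq → w-ext (shift₀-cong eq)) g g↑) (m≤m+n _ _))
... | inj₂ (g , g↑ , f≗) = ≤-trans (≤-reflexive (w-ext f≗))
  (≤-trans (term≤∑↑ (suc k) n (w ∘ shift) (λ eq → w-ext (cong suc ∘ eq)) g g↑) (m≤n+m _ _))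

increasing⇒≤ : (f : Map k n) → Increasing f → k ≤ n
increasing⇒≤ f f↑ = Fin.injective⇒≤ injective
  where
  injective : ∀ {i j} → f i ≡ f j → i ≡ j
  injective {i} {j} fi≡fj with Fin.<-cmp i j
  ... | tri< i<j _ _ = ⊥-elim (Fin.<-irrefl fi≡fj (f↑ i j i<j))
  ... | tri≈ _ i≡j _ = i≡j
  ... | tri> _ _ j<i = ⊥-elim (Fin.<-irrefl (sym fi≡fj) (f↑ j i j<i))

-- Double counting

*-distrib-+-split : ∀ c c₁ c₂ a b → b ≡ 0 ⊎ c ≡ c₁ + c₂ → c * a + c₁ * b + c₂ * b ≡ c * (a + b)
*-distrib-+-split c c₁ c₂ a .0 (inj₁ refl) = vanish c c₁ c₂ a
  where
  vanish : ∀ c c₁ c₂ a → c * a + c₁ * 0 + c₂ * 0 ≡ c * (a + 0)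
  vanish = solve-∀
*-distrib-+-split .(c₁ + c₂) c₁ c₂ a b (inj₂ refl) = distrib c₁ c₂ a b
  where
  distrib : ∀ c₁ c₂ a b → (c₁ + c₂) * a + c₁ * b + c₂ * b ≡ (c₁ + c₂) * (a + b)
  distrib = solve-∀

-- For k ≤ σ this is (n ∸ k) C (σ ∸ k), the number of σ-subsets of Fin n containing a
-- given k-subset; only the recursion is ever used.
supersets : ℕ → ℕ → ℕ → ℕ
supersets zero    σ       n       = n C σ
supersets (suc k) zero    n       = 0
supersets (suc k) (suc σ) zero    = 0
supersets (suc k) (suc σ) (suc n) = supersets k σ n

supersets-pascal : ∀ k σ n → k < n → supersets k σ n ≡ supersets (suc k) σ n + supersets (suc k) (suc σ) n
supersets-pascal zero    zero    (suc n) _         = refl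
supersets-pascal zero    (suc σ) (suc n) _         = sym (nCk+nC[k+1]≡[n+1]C[k+1] n σ)
supersets-pascal (suc k) zero    (suc n) _         = refl
supersets-pascal (suc k) (suc σ) (suc n) (s≤s k<n) = supersets-pascal k σ n k<n

supersets>0 : k ≤ σ → σ ≤ n → 0 < supersets k σ n
supersets>0 {zero}                  _         σ≤n       = C>0 σ≤n
supersets>0 {suc k} {suc σ} {suc n} (s≤s k≤σ) (s≤s σ≤n) = supersets>0 k≤σ σ≤n

-- Double counting the pairs (k-subset ⊆ σ-subset) of Fin n.
∑↑-∘ : ∀ k σ n (w : Weight k n) → Extensional w →
       ∑↑ σ n (λ g → ∑↑ k σ (λ φ → w (g ∘ φ))) ≡ supersets k σ n * ∑↑ k n w
∑↑-∘ zero    σ       n       w w-ext =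
  trans (∑↑-cong σ n (λ g → w-ext (λ ()))) (∑↑-const σ n (w (λ ())))
∑↑-∘ (suc k) zero    n       w w-ext = refl
∑↑-∘ (suc k) (suc σ) zero    w w-ext = refl
∑↑-∘ (suc k) (suc σ) (suc n) w w-ext = begin
  ∑↑ σ n (λ g → ∑↑ k σ (λ φ → w (shift₀ g ∘ shift₀ φ)) + inner₊ g) + outer₊
    ≡⟨ cong (_+ outer₊) (trans (∑↑-cong σ n (λ g → cong (_+ inner₊ g) (∑↑-cong k σ (w-ext ∘ shift₀-∘ g))))
                               (∑↑-+ σ n inner₀ inner₊)) ⟩
  ∑↑ σ n inner₀ + ∑↑ σ n inner₊ + outer₊
    ≡⟨ cong₂ _+_ (cong₂ _+_ (∑↑-∘ k σ n w₀ (λ eq → w-ext (shift₀-cong eq)))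
                            (∑↑-∘ (suc k) σ n w₊ (λ eq → w-ext (cong suc ∘ eq))))
                 (∑↑-∘ (suc k) (suc σ) n w₊ (λ eq → w-ext (cong suc ∘ eq))) ⟩
  c * A + c₁ * B + c₂ * B
    ≡⟨ regroup ⟩
  c * (A + B) ∎
  where
  open ≡-Reasoning
  w₀ : Weight k n
  w₀ = w ∘ shift₀
  w₊ : Weight (suc k) n
  w₊ = w ∘ shift
  inner₀ inner₊ : Map σ n → ℕ
  inner₀ g = ∑↑ k σ (λ φ → w₀ (g ∘ φ))
  inner₊ g = ∑↑ (suc k) σ (λ φ → w₊ (g ∘ φ))
  outer₊ = ∑↑ (suc σ) n (λ g → ∑↑ (suc k) (suc σ) (λ φ → w₊ (g ∘ φ)))
  A = ∑↑ k n w₀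
  B = ∑↑ (suc k) n w₊
  c = supersets k σ n
  c₁ = supersets (suc k) σ n
  c₂ = supersets (suc k) (suc σ) n
  shift₀-∘ : ∀ (g : Map σ n) (φ : Map k σ) → shift₀ g ∘ shift₀ φ ≗ shift₀ (g ∘ φ)
  shift₀-∘ g φ zero    = refl
  shift₀-∘ g φ (suc i) = refl
  regroup : c * A + c₁ * B + c₂ * B ≡ c * (A + B)
  regroup with k <? n
  ... | yes k<n = *-distrib-+-split c c₁ c₂ A B (inj₂ (supersets-pascal k σ n k<n))
  ... | no  k≮n = *-distrib-+-split c c₁ c₂ A B (inj₁ (∑↑-empty (suc k) n (s≤s (≮⇒≥ k≮n))))

C*C≡supersets*C : ∀ k σ n → (n C σ) * (σ C k) ≡ supersets k σ n * (n C k)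
C*C≡supersets*C k σ n = begin
  (n C σ) * (σ C k)                              ≡⟨ ∑↑-const σ n (σ C k) ⟨
  ∑↑ σ n (const (σ C k))                         ≡⟨ ∑↑-cong σ n (λ _ → ∑↑-count k σ) ⟨
  ∑↑ σ n (λ g → ∑↑ k σ (λ φ → const 1 (g ∘ φ)))  ≡⟨ ∑↑-∘ k σ n (const 1) (λ _ → refl) ⟩
  supersets k σ n * ∑↑ k n (const 1)             ≡⟨ cong (supersets k σ n *_) (∑↑-count k n) ⟩
  supersets k σ n * (n C k)                      ∎
  where open ≡-Reasoning

-- Sums over all maps

indicator : {P : Set} → Dec P → ℕ
indicator P? = if does P? then 1 else 0

indicator-yes : {P : Set} (P? : Dec P) → P → indicator P? ≡ 1
indicator-yes (yes _) _ = refl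
indicator-yes (no ¬p) p = ⊥-elim (¬p p)

indicator-no : {P : Set} (P? : Dec P) → ¬ P → indicator P? ≡ 0
indicator-no (yes p) ¬p = ⊥-elim (¬p p)
indicator-no (no _)  _  = refl

indicator-*-≤ : {P Q R : Set} (P? : Dec P) (Q? : Dec Q) (R? : Dec R) → (P → Q → R) →
                indicator P? * indicator Q? ≤ indicator R?
indicator-*-≤ (no _)  _       _       _     = z≤n
indicator-*-≤ (yes _) (no _)  _       _     = z≤n
indicator-*-≤ (yes p) (yes q) R?      P⇒Q⇒R = ≤-reflexive (sym (indicator-yes R? (P⇒Q⇒R p q)))

indicator-cong : {P Q : Set} (P? : Dec P) (Q? : Dec Q) → (P → Q) → (Q → P) → indicator P? ≡ indicator Q?
indicator-cong (yes _) (yes _) _   _   = refl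
indicator-cong (yes p) (no ¬q) P⇒Q _   = ⊥-elim (¬q (P⇒Q p))
indicator-cong (no ¬p) (yes q) _   Q⇒P = ⊥-elim (¬p (Q⇒P q))
indicator-cong (no _)  (no _)  _   _   = refl

length-filter≡sum-indicator : {A : Set} {P : A → Set} (P? : ∀ x → Dec (P x)) (xs : List A) →
                              length (filter P? xs) ≡ sum (map (indicator ∘ P?) xs)
length-filter≡sum-indicator P? List.[]       = refl
length-filter≡sum-indicator P? (x List.∷ xs) with does (P? x)
... | true  = cong suc (length-filter≡sum-indicator P? xs)
... | false = length-filter≡sum-indicator P? xs

sum-map-concatMap : {A B : Set} (w : B → ℕ) (h : A → List B) (xs : List A) →
                    sum (map w (concatMap h xs)) ≡ sum (map (λ x → sum (map w (h x))) xs)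
sum-map-concatMap w h List.[]       = refl
sum-map-concatMap w h (x List.∷ xs) = begin
  sum (map w (h x List.++ concatMap h xs))          ≡⟨ cong sum (map-++ w (h x) (concatMap h xs)) ⟩
  sum (map w (h x) List.++ map w (concatMap h xs))  ≡⟨ sum-++ (map w (h x)) (map w (concatMap h xs)) ⟩
  sum (map w (h x)) + sum (map w (concatMap h xs))  ≡⟨ cong (sum (map w (h x)) +_) (sum-map-concatMap w h xs) ⟩
  sum (map w (h x)) + sum (map (λ x → sum (map w (h x))) xs) ∎
  where open ≡-Reasoning

sum-tabulate : ∀ n (f : Fin n → ℕ) → sum (tabulate f) ≡ ∑ f
sum-tabulate zero    f = refl
sum-tabulate (suc n) f = cong (f zero +_) (sum-tabulate n (f ∘ suc))

sum-map-allFin : ∀ n (f : Fin n → ℕ) → sum (map f (allFin n)) ≡ ∑ f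
sum-map-allFin n f = trans (cong sum (map-tabulate id f)) (sum-tabulate n f)

∑→ : (k n : ℕ) → Weight k n → ℕ
∑→ zero    n w = w (λ ())
∑→ (suc k) n w = ∑ (λ x → ∑→ k n (w ∘ (x ∷_)))

∑→-cong : ∀ k n {w v : Weight k n} → w ≗ v → ∑→ k n w ≡ ∑→ k n v
∑→-cong zero    n w≗v = w≗v _
∑→-cong (suc k) n w≗v = sum-cong-≗ (λ x → ∑→-cong k n (λ g → w≗v (x ∷ g)))

∑→-zero : ∀ k n {w : Weight k n} → (∀ f → w f ≡ 0) → ∑→ k n w ≡ 0
∑→-zero zero    n w≗0 = w≗0 _
∑→-zero (suc k) n w≗0 =
  trans (sum-cong-≗ (λ x → ∑→-zero k n (λ g → w≗0 (x ∷ g)))) (sum-replicate-zero n)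

∷-cong : ∀ (x : Fin n) {g h : Map k n} → g ≗ h → (x ∷ g) ≗ (x ∷ h)
∷-cong x g≗h zero    = refl
∷-cong x g≗h (suc i) = g≗h i

shift-∷ : ∀ (x : Fin n) (g : Map k n) → shift (x ∷ g) ≗ (suc x ∷ shift g)
shift-∷ x g zero    = refl
shift-∷ x g (suc i) = refl

∑→-avoiding-zero : ∀ k n (w : Weight k (suc n)) → Extensional w → (∀ f i → f i ≡ zero → w f ≡ 0) →
                   ∑→ k (suc n) w ≡ ∑→ k n (w ∘ shift)
∑→-avoiding-zero zero    n w w-ext w-zero = w-ext (λ ())
∑→-avoiding-zero (suc k) n w w-ext w-zero =
  cong₂ _+_ (∑→-zero k (suc n) (λ g → w-zero _ zero refl))
            (sum-cong-≗ (λ y → trans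
              (∑→-avoiding-zero k n (w ∘ (suc y ∷_)) (λ eq → w-ext (∷-cong (suc y) eq))
                                (λ f i fi≡0 → w-zero _ (suc i) fi≡0))
              (∑→-cong k n (λ g → w-ext (sym ∘ shift-∷ y g)))))

SupportedOnIncreasing : Weight k n → Set
SupportedOnIncreasing w = ∀ f → ¬ Increasing f → w f ≡ 0

shift-increasing⁻¹ : {g : Map k n} → Increasing (shift g) → Increasing g
shift-increasing⁻¹ g↑ i j i<j = s<s⁻¹ (g↑ i j i<j)

shift₀-increasing⁻¹ : {g : Map k n} → Increasing (shift₀ g) → Increasing g
shift₀-increasing⁻¹ g↑ i j i<j = s<s⁻¹ (g↑ (suc i) (suc j) (s≤s i<j))

∷-increasing⇒tail-positive : {x : Fin n} {g : Map k n} → Increasing (x ∷ g) → ∀ i → Positive (g i)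
∷-increasing⇒tail-positive g↑ i = ≤-trans (s≤s z≤n) (g↑ zero (suc i) (s≤s z≤n))

∑→≡∑↑ : ∀ k n (w : Weight k n) → Extensional w → SupportedOnIncreasing w → ∑→ k n w ≡ ∑↑ k n w
∑→≡∑↑ zero    n       w w-ext w-supp = refl
∑→≡∑↑ (suc k) zero    w w-ext w-supp = refl
∑→≡∑↑ (suc k) (suc n) w w-ext w-supp = cong₂ _+_
  (trans (∑→-avoiding-zero k n (w ∘ (zero ∷_)) (λ eq → w-ext (∷-cong zero eq)) (tail-zero zero))
         (∑→≡∑↑ k n (w ∘ shift₀) (λ eq → w-ext (shift₀-cong eq))
                (λ f ¬f↑ → w-supp _ (¬f↑ ∘ shift₀-increasing⁻¹))))
  (trans (sum-cong-≗ (λ y → trans (∑→-avoiding-zero k n (w ∘ (suc y ∷_)) (λ eq → w-ext (∷-cong (suc y) eq))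
                                                    (tail-zero (suc y)))
                                  (∑→-cong k n (λ g → w-ext (sym ∘ shift-∷ y g)))))
         (∑→≡∑↑ (suc k) n (w ∘ shift) (λ eq → w-ext (cong suc ∘ eq))
                (λ f ¬f↑ → w-supp _ (¬f↑ ∘ shift-increasing⁻¹))))
  where
  tail-zero : ∀ x (g : Map k (suc n)) i → g i ≡ zero → w (x ∷ g) ≡ 0
  tail-zero x g i gi≡0 =
    w-supp _ (λ x∷g↑ → <-irrefl refl (subst Positive gi≡0 (∷-increasing⇒tail-positive x∷g↑ i)))

sum-map-allFuns : ∀ k n (w : Weight k n) → Extensional w → sum (map w (allFuns k n)) ≡ ∑→ k n w
sum-map-allFuns zero    n w w-ext = trans (+-identityʳ _) (w-ext (λ ()))
sum-map-allFuns (suc k) n w w-ext = begin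
  sum (map w (allFuns (suc k) n))
    ≡⟨ sum-map-concatMap w _ (allFin n) ⟩
  sum (map (λ x → sum (map w (map (x ∷_) (allFuns k n)))) (allFin n))
    ≡⟨ cong sum (map-cong (λ x → cong sum (sym (map-∘ (allFuns k n)))) (allFin n)) ⟩
  sum (map (λ x → sum (map (w ∘ (x ∷_)) (allFuns k n))) (allFin n))
    ≡⟨ cong sum (map-cong (λ x → sum-map-allFuns k n (w ∘ (x ∷_)) (λ eq → w-ext (∷-cong x eq))) (allFin n)) ⟩
  sum (map (λ x → ∑→ k n (w ∘ (x ∷_))) (allFin n))
    ≡⟨ sum-map-allFin n _ ⟩
  ∑→ (suc k) n w ∎
  where open ≡-Reasoning

-- Copies and edges

EdgeSet : ℕ → Set
EdgeSet n = Fin n → Fin n → Bool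

copies : (H : OGraph) → EdgeSet n → Weight (size H) n
copies H E f = indicator (isCopy? H E f)

IsCopy-cong : (H : OGraph) (E : EdgeSet n) {f g : Map (size H) n} → f ≗ g →
              IsCopy H (InE E) f → IsCopy H (InE E) g
IsCopy-cong H E f≗g (f↑ , f-edges) =
  (λ i j i<j → subst₂ Fin._<_ (f≗g i) (f≗g j) (f↑ i j i<j)) ,
  (λ i j i<j ij∈H → subst₂ (InE E) (f≗g i) (f≗g j) (f-edges i j i<j ij∈H))

copies-extensional : (H : OGraph) (E : EdgeSet n) → Extensional (copies H E)
copies-extensional H E f≗g =
  indicator-cong (isCopy? H E _) (isCopy? H E _) (IsCopy-cong H E f≗g) (IsCopy-cong H E (sym ∘ f≗g))

numCopies≡∑↑ : (H : OGraph) (E : EdgeSet n) → numCopies H n E ≡ ∑↑ (size H) n (copies H E)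
numCopies≡∑↑ {n} H E = begin
  numCopies H n E
    ≡⟨ length-filter≡sum-indicator (isCopy? H E) (allFuns (size H) n) ⟩
  sum (map (copies H E) (allFuns (size H) n))
    ≡⟨ sum-map-allFuns (size H) n (copies H E) (copies-extensional H E) ⟩
  ∑→ (size H) n (copies H E)
    ≡⟨ ∑→≡∑↑ (size H) n (copies H E) (copies-extensional H E) supported ⟩
  ∑↑ (size H) n (copies H E) ∎
  where
  open ≡-Reasoning
  supported : SupportedOnIncreasing (copies H E)
  supported f ¬f↑ = indicator-no (isCopy? H E f) (¬f↑ ∘ proj₁)

edge? : (E : EdgeSet n) (p : Fin n × Fin n) → Dec (proj₁ p Fin.< proj₂ p × E (proj₁ p) (proj₂ p) ≡ true)
edge? E p = (proj₁ p Fin.<? proj₂ p) ×-dec (E (proj₁ p) (proj₂ p) Bool.≟ true)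

edges : EdgeSet n → Weight 2 n
edges E f = indicator (edge? E (f zero , f (suc zero)))

edges-extensional : (E : EdgeSet n) → Extensional (edges E)
edges-extensional E f≗g = cong₂ (λ a b → indicator (edge? E (a , b))) (f≗g zero) (f≗g (suc zero))

pair-increasing : (f : Map 2 n) → f zero Fin.< f (suc zero) → Increasing f
pair-increasing f f₀<f₁ zero    (suc zero) _ = f₀<f₁
pair-increasing f f₀<f₁ (suc zero) (suc zero) (s≤s ())

countEdges≡∑↑ : ∀ n (E : EdgeSet n) → countEdges n E ≡ ∑↑ 2 n (edges E)
countEdges≡∑↑ n E = begin
  countEdges n E
    ≡⟨ length-filter≡sum-indicator (edge? E) (allPairs n) ⟩
  sum (map (indicator ∘ edge? E) (allPairs n))
    ≡⟨ sum-map-concatMap (indicator ∘ edge? E) _ (allFin n) ⟩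
  sum (map (λ i → sum (map (indicator ∘ edge? E) (map (i ,_) (allFin n)))) (allFin n))
    ≡⟨ cong sum (map-cong (λ i → trans (cong sum (sym (map-∘ (allFin n)))) (sum-map-allFin n _)) (allFin n)) ⟩
  sum (map (λ i → ∑ (λ j → indicator (edge? E (i , j)))) (allFin n))
    ≡⟨ sum-map-allFin n _ ⟩
  ∑→ 2 n (edges E)
    ≡⟨ ∑→≡∑↑ 2 n (edges E) (edges-extensional E) supported ⟩
  ∑↑ 2 n (edges E) ∎
  where
  open ≡-Reasoning
  supported : SupportedOnIncreasing (edges E)
  supported f ¬f↑ = indicator-no (edge? E _) (¬f↑ ∘ pair-increasing f ∘ proj₁)

complement : EdgeSet n → EdgeSet n
complement E a b = not (E a b)

edges+edges-complement : (E : EdgeSet n) (p : Map 2 n) → Increasing p → edges E p + edges (complement E) p ≡ 1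
edges+edges-complement E p p↑ = by-membership (E (p zero) (p (suc zero))) refl
  where
  p₀<p₁ : p zero Fin.< p (suc zero)
  p₀<p₁ = p↑ zero (suc zero) (s≤s z≤n)
  by-membership : ∀ b → E (p zero) (p (suc zero)) ≡ b → edges E p + edges (complement E) p ≡ 1
  by-membership true  p∈E = cong₂ _+_
    (indicator-yes (edge? E _) (p₀<p₁ , p∈E))
    (indicator-no (edge? (complement E) _) (λ (_ , p∈Eᶜ) → Bool.not-¬ refl (trans p∈E (sym p∈Eᶜ))))
  by-membership false p∉E = cong₂ _+_
    (indicator-no (edge? E _) (λ (_ , p∈E) → Bool.not-¬ p∉E p∈E))
    (indicator-yes (edge? (complement E) _) (p₀<p₁ , cong not p∉E))

countEdges+countEdges-complement : ∀ n (E : EdgeSet n) → countEdges n E + countEdges n (complement E) ≡ n C 2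
countEdges+countEdges-complement n E = begin
  countEdges n E + countEdges n (complement E)
    ≡⟨ cong₂ _+_ (countEdges≡∑↑ n E) (countEdges≡∑↑ n (complement E)) ⟩
  ∑↑ 2 n (edges E) + ∑↑ 2 n (edges (complement E))
    ≡⟨ ∑↑-+ 2 n (edges E) (edges (complement E)) ⟨
  ∑↑ 2 n (λ p → edges E p + edges (complement E) p)
    ≡⟨ ∑↑-cong↑ 2 n (edges+edges-complement E) ⟩
  ∑↑ 2 n (const 1)
    ≡⟨ ∑↑-count 2 n ⟩
  n C 2 ∎
  where open ≡-Reasoning

copies*edges≤edges-∘ : (H : OGraph) (E : EdgeSet n) (f : Map (size H) n) (ψ : Map 2 (size H)) → Increasing ψ →
            copies H E f * edges (adj H) ψ ≤ edges E (f ∘ ψ)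
copies*edges≤edges-∘ H E f ψ ψ↑ = indicator-*-≤ (isCopy? H E f) (edge? (adj H) _) (edge? E _)
  (λ (f↑ , f-edges) (ψ₀<ψ₁ , ψ∈H) → f↑ _ _ ψ₀<ψ₁ , f-edges _ _ ψ₀<ψ₁ ψ∈H)

numEdges*numCopies≤ : (H : OGraph) (E : EdgeSet n) →
                      numEdges H * numCopies H n E ≤ supersets 2 (size H) n * countEdges n E
numEdges*numCopies≤ {n} H E = begin
  numEdges H * numCopies H n E
    ≡⟨ cong₂ _*_ (countEdges≡∑↑ (size H) (adj H)) (numCopies≡∑↑ H E) ⟩
  e * ∑↑ (size H) n (copies H E)
    ≡⟨ ∑↑-*ˡ (size H) n e (copies H E) ⟨
  ∑↑ (size H) n (λ f → e * copies H E f)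
    ≤⟨ ∑↑-mono (size H) n (λ f _ → edges-in-copy f) ⟩
  ∑↑ (size H) n (λ f → ∑↑ 2 (size H) (λ ψ → edges E (f ∘ ψ)))
    ≡⟨ ∑↑-∘ 2 (size H) n (edges E) (edges-extensional E) ⟩
  supersets 2 (size H) n * ∑↑ 2 n (edges E)
    ≡⟨ cong (supersets 2 (size H) n *_) (countEdges≡∑↑ n E) ⟨
  supersets 2 (size H) n * countEdges n E ∎
  where
  open ≤-Reasoning
  e = ∑↑ 2 (size H) (edges (adj H))
  edges-in-copy : ∀ f → e * copies H E f ≤ ∑↑ 2 (size H) (λ ψ → edges E (f ∘ ψ))
  edges-in-copy f = begin
    e * copies H E f                                      ≡⟨ *-comm e (copies H E f) ⟩
    copies H E f * e                                      ≡⟨ ∑↑-*ˡ 2 (size H) (copies H E f) (edges (adj H)) ⟨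
    ∑↑ 2 (size H) (λ ψ → copies H E f * edges (adj H) ψ)  ≤⟨ ∑↑-mono 2 (size H) (copies*edges≤edges-∘ H E f) ⟩
    ∑↑ 2 (size H) (λ ψ → edges E (f ∘ ψ))                 ∎

copies⇒edges : (H : OGraph) (E : EdgeSet n) (t : ℕ) → size H ≤ n →
               (size H C 2) * (n C size H) ≤ t * numCopies H n E → numEdges H * (n C 2) ≤ t * countEdges n E
copies⇒edges {n} H E t h≤n many with 2 ≤? size H
... | no h<2  = subst (λ e → e * (n C 2) ≤ t * countEdges n E) (sym no-edges) z≤n
  where
  no-edges : numEdges H ≡ 0
  no-edges = trans (countEdges≡∑↑ (size H) (adj H)) (∑↑-empty 2 (size H) (≰⇒> h<2))
... | yes 2≤h = *-cancelˡ-≤ c {{>-nonZero (supersets>0 2≤h h≤n)}} (begin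
  c * (e * (n C 2))              ≡⟨ x*[y*z]≡y*[x*z] c e (n C 2) ⟩
  e * (c * (n C 2))              ≡⟨ cong (e *_) (trans (*-comm (h C 2) (n C h)) (C*C≡supersets*C 2 h n)) ⟨
  e * ((h C 2) * (n C h))        ≤⟨ *-monoʳ-≤ e many ⟩
  e * (t * numCopies H n E)      ≡⟨ x*[y*z]≡y*[x*z] e t (numCopies H n E) ⟩
  t * (e * numCopies H n E)      ≤⟨ *-monoʳ-≤ t (numEdges*numCopies≤ H E) ⟩
  t * (c * countEdges n E)       ≡⟨ x*[y*z]≡y*[x*z] t c (countEdges n E) ⟩
  c * (t * countEdges n E)       ∎)
  where
  open ≤-Reasoning
  h = size H
  c = supersets 2 h n
  e = numEdges H

-- The Ramsey colouring

colour : Bool → Bool → Fin 3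
colour true  _     = zero
colour false true  = suc zero
colour false false = suc (suc zero)

inClass : Fin 3 → Bool → Bool → Bool
inClass zero             b₁ b₂ = b₁
inClass (suc zero)       b₁ b₂ = b₂
inClass (suc (suc zero)) b₁ b₂ = not (b₁ ∨ b₂)

inClass-colour : ∀ b₁ b₂ → inClass (colour b₁ b₂) b₁ b₂ ≡ true
inClass-colour true  _     = refl
inClass-colour false true  = refl
inClass-colour false false = refl

colourClass : EdgeSet n → EdgeSet n → Fin 3 → EdgeSet n
colourClass E₁ E₂ col a b = inClass col (E₁ a b) (E₂ a b)

allCopies : (H : OGraph) → EdgeSet n → EdgeSet n → Weight (size H) n
allCopies H E₁ E₂ f = copies H E₁ f + copies H E₂ f + copies H (complement (E₁ ∪E E₂)) f

copies-colourClass≤allCopies : (H : OGraph) (E₁ E₂ : EdgeSet n) (f : Map (size H) n) →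
                              ∀ col → copies H (colourClass E₁ E₂ col) f ≤ allCopies H E₁ E₂ f
copies-colourClass≤allCopies H E₁ E₂ f zero             =
  ≤-trans (m≤m+n (copies H E₁ f) (copies H E₂ f)) (m≤m+n _ (copies H (complement (E₁ ∪E E₂)) f))
copies-colourClass≤allCopies H E₁ E₂ f (suc zero)       =
  ≤-trans (m≤n+m (copies H E₂ f) (copies H E₁ f)) (m≤m+n _ (copies H (complement (E₁ ∪E E₂)) f))
copies-colourClass≤allCopies H E₁ E₂ f (suc (suc zero)) = m≤n+m (copies H (complement (E₁ ∪E E₂)) f) _

allCopies-extensional : (H : OGraph) (E₁ E₂ : EdgeSet n) → Extensional (allCopies H E₁ E₂)
allCopies-extensional H E₁ E₂ f≗g =
  cong₂ _+_ (cong₂ _+_ (copies-extensional H E₁ f≗g) (copies-extensional H E₂ f≗g))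
            (copies-extensional H (complement (E₁ ∪E E₂)) f≗g)

copy-in-σ-subset : (H : OGraph) → Arrows3 σ H → (E₁ E₂ : EdgeSet n) (g : Map σ n) → Increasing g →
                   1 ≤ ∑↑ (size H) σ (λ φ → allCopies H E₁ E₂ (g ∘ φ))
copy-in-σ-subset {σ} H arrows E₁ E₂ g g↑ with arrows (λ a b → colour (E₁ (g a) (g b)) (E₂ (g a) (g b)))
... | col , φ , φ↑ , φ-monochromatic = begin
  1
    ≡⟨ indicator-yes (isCopy? H (colourClass E₁ E₂ col) (g ∘ φ)) g∘φ-copy ⟨
  copies H (colourClass E₁ E₂ col) (g ∘ φ)
    ≤⟨ copies-colourClass≤allCopies H E₁ E₂ (g ∘ φ) col ⟩
  allCopies H E₁ E₂ (g ∘ φ)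
    ≤⟨ term≤∑↑ (size H) σ _ (λ eq → allCopies-extensional H E₁ E₂ (cong g ∘ eq)) φ φ↑ ⟩
  ∑↑ (size H) σ (λ φ → allCopies H E₁ E₂ (g ∘ φ)) ∎
  where
  open ≤-Reasoning
  g∘φ-copy : IsCopy H (InE (colourClass E₁ E₂ col)) (g ∘ φ)
  g∘φ-copy = (λ i j i<j → g↑ _ _ (φ↑ i j i<j)) ,
             (λ i j i<j ij∈H → subst (λ c → inClass c _ _ ≡ true) (φ-monochromatic i j i<j ij∈H)
                                   (inClass-colour (E₁ (g (φ i)) (g (φ j))) (E₂ (g (φ i)) (g (φ j)))))

arrows⇒size≤ : (H : OGraph) → Arrows3 σ H → size H ≤ σ
arrows⇒size≤ H arrows = increasing⇒≤ _ (proj₁ (proj₂ (proj₂ (arrows (λ _ _ → zero)))))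

∑↑-allCopies : (H : OGraph) (E₁ E₂ : EdgeSet n) →
               ∑↑ (size H) n (allCopies H E₁ E₂)
               ≡ numCopies H n E₁ + numCopies H n E₂ + numCopies H n (complement (E₁ ∪E E₂))
∑↑-allCopies {n} H E₁ E₂ =
  trans (∑↑-+ (size H) n _ (copies H (complement (E₁ ∪E E₂))))
        (sym (cong₂ _+_ (trans (cong₂ _+_ (numCopies≡∑↑ H E₁) (numCopies≡∑↑ H E₂))
                               (sym (∑↑-+ (size H) n (copies H E₁) (copies H E₂))))
                        (numCopies≡∑↑ H (complement (E₁ ∪E E₂)))))

ramsey-count : (H : OGraph) → Arrows3 σ H → σ ≤ n → (E₁ E₂ : EdgeSet n) →
               n C size H ≤ (σ C size H) * (numCopies H n E₁ + numCopies H n E₂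
                                            + numCopies H n (complement (E₁ ∪E E₂)))
ramsey-count {σ} {n} H arrows σ≤n E₁ E₂ =
  *-cancelˡ-≤ c {{>-nonZero (supersets>0 (arrows⇒size≤ H arrows) σ≤n)}} (begin
  c * (n C h)          ≡⟨ C*C≡supersets*C h σ n ⟨
  (n C σ) * (σ C h)    ≤⟨ *-monoˡ-≤ (σ C h) σ-subsets≤ ⟩
  c * N * (σ C h)      ≡⟨ *-assoc c N (σ C h) ⟩
  c * (N * (σ C h))    ≡⟨ cong (c *_) (*-comm N (σ C h)) ⟩
  c * ((σ C h) * N)    ∎)
  where
  open ≤-Reasoning
  h = size H
  c = supersets h σ n
  N = numCopies H n E₁ + numCopies H n E₂ + numCopies H n (complement (E₁ ∪E E₂))
  σ-subsets≤ : n C σ ≤ c * N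
  σ-subsets≤ = begin
    n C σ                                                    ≡⟨ ∑↑-count σ n ⟨
    ∑↑ σ n (const 1)
      ≤⟨ ∑↑-mono σ n (copy-in-σ-subset H arrows E₁ E₂) ⟩
    ∑↑ σ n (λ g → ∑↑ h σ (λ φ → allCopies H E₁ E₂ (g ∘ φ)))
      ≡⟨ ∑↑-∘ h σ n _ (allCopies-extensional H E₁ E₂) ⟩
    c * ∑↑ h n (allCopies H E₁ E₂)                           ≡⟨ cong (c *_) (∑↑-allCopies H E₁ E₂) ⟩
    c * N                                                    ∎

supersaturation : (H : OGraph) → Arrows3 σ H → σ ≤ n → (E₁ E₂ : EdgeSet n) →
                  4 * σ ^ σ * numCopies H n E₁ ≤ n ^ size H → 4 * σ ^ σ * numCopies H n E₂ ≤ n ^ size H →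
                  (size H C 2) * (n C size H) ≤ 2 * σ ^ σ * numCopies H n (complement (E₁ ∪E E₂))
supersaturation {σ} {n} H arrows σ≤n E₁ E₂ few₁ few₂ =
  *-cancelˡ-≤ a {{>-nonZero (C>0 h≤σ)}} (+-cancelʳ-≤ (a * n ^ h) _ _ (begin
    a * ((h C 2) * (n C h)) + a * n ^ h    ≡⟨ *-distribˡ-+ a ((h C 2) * (n C h)) (n ^ h) ⟨
    a * ((h C 2) * (n C h) + n ^ h)        ≤⟨ binomial-estimate h≤σ σ≤n ⟩
    2 * S * (n C h)                        ≤⟨ *-cancelˡ-≤ 2 twice ⟩
    a * n ^ h + a * (2 * S * N₃)           ≡⟨ +-comm (a * n ^ h) (a * (2 * S * N₃)) ⟩
    a * (2 * S * N₃) + a * n ^ h           ∎))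
  where
  open ≤-Reasoning
  h = size H
  h≤σ = arrows⇒size≤ H arrows
  a = σ C h
  S = σ ^ σ
  N₁ = numCopies H n E₁
  N₂ = numCopies H n E₂
  N₃ = numCopies H n (complement (E₁ ∪E E₂))
  twice : 2 * (2 * S * (n C h)) ≤ 2 * (a * n ^ h + a * (2 * S * N₃))
  twice = begin
    2 * (2 * S * (n C h))                           ≡⟨ quadruple S (n C h) ⟩
    4 * S * (n C h)                                 ≤⟨ *-monoʳ-≤ (4 * S) (ramsey-count H arrows σ≤n E₁ E₂) ⟩
    4 * S * (a * (N₁ + N₂ + N₃))                    ≡⟨ spread S a N₁ N₂ N₃ ⟩
    a * (4 * S * N₁ + 4 * S * N₂ + 4 * S * N₃)      ≤⟨ *-monoʳ-≤ a (+-monoˡ-≤ (4 * S * N₃) (+-mono-≤ few₁ few₂)) ⟩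
    a * (n ^ h + n ^ h + 4 * S * N₃)                ≡⟨ collect a (n ^ h) S N₃ ⟩
    2 * (a * n ^ h + a * (2 * S * N₃))              ∎
    where
    quadruple : ∀ S x → 2 * (2 * S * x) ≡ 4 * S * x
    quadruple = solve-∀
    spread : ∀ S a x y z → 4 * S * (a * (x + y + z)) ≡ a * (4 * S * x + 4 * S * y + 4 * S * z)
    spread = solve-∀
    collect : ∀ a p S z → a * (p + p + 4 * S * z) ≡ 2 * (a * p + a * (2 * S * z))
    collect = solve-∀

lemma19 : (H : OGraph) (σ : ℕ) → IsRamsey3 H σ →
          (n : ℕ) → σ ≤ n →
          (E₁ E₂ : Fin n → Fin n → Bool) →
          4 * σ ^ σ * numCopies H n E₁ ≤ n ^ size H →
          4 * σ ^ σ * numCopies H n E₂ ≤ n ^ size H →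
          2 * σ ^ σ * countEdges n (E₁ ∪E E₂) + numEdges H * (n C 2) ≤ 2 * σ ^ σ * (n C 2)
lemma19 H σ (arrows , _) n σ≤n E₁ E₂ few₁ few₂ = begin
  2 * σ ^ σ * countEdges n E + numEdges H * (n C 2)
    ≤⟨ +-monoʳ-≤ (2 * σ ^ σ * countEdges n E) many-non-edges ⟩
  2 * σ ^ σ * countEdges n E + 2 * σ ^ σ * countEdges n (complement E)
    ≡⟨ *-distribˡ-+ (2 * σ ^ σ) (countEdges n E) (countEdges n (complement E)) ⟨
  2 * σ ^ σ * (countEdges n E + countEdges n (complement E))
    ≡⟨ cong (2 * σ ^ σ *_) (countEdges+countEdges-complement n E) ⟩
  2 * σ ^ σ * (n C 2) ∎
  where
  open ≤-Reasoning
  E = E₁ ∪E E₂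
  many-non-edges : numEdges H * (n C 2) ≤ 2 * σ ^ σ * countEdges n (complement E)
  many-non-edges = copies⇒edges H (complement E) (2 * σ ^ σ) (≤-trans (arrows⇒size≤ H arrows) σ≤n)
                                (supersaturation H arrows σ≤n E₁ E₂ few₁ few₂)
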